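{- There exists a permutation of the integers $\mathbb{Z}$ that avoids arithmetic progressions of length $6$.
   Context: A permutation of $\mathbb{Z}$ is a sequence $p_1,p_2,p_3,\dots$ in which every integer appears exactly once. A permutation (of $\mathbb{Z}$, of the positive integers, or of a finite set) contains an arithmetic progression of length $k$ if there are indices $i_1<i_2<\dots<i_k$ and integers $a$ and $d\neq 0$ with $p_{i_j}=a+(j-1)d$ for $j=1,\dots,k$; it avoids arithmetic progressions of length $k$ otherwise. Here $d$ may be negative. -}

module Defs where

open import Data.Nat using (ℕ) renaming (_<_ to _<ℕ_)
open import Data.Fin using (Fin; toℕ)
import Data.Fin as Fin
open import Data.Integer using (ℤ; +_; _+_; _*_; 0ℤ)
open import Data.Product using (Σ; ∃; _×_)
open import Relation.Binary.PropositionalEquality using (_≡_; _≢_)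
open import Relation.Nullary using (¬_)
open import Function.Definitions using (Bijective)

-- A permutation of ℤ: a sequence p₀, p₁, p₂, … (0-indexed here; the paper
-- indexes from 1) in which every integer appears exactly once, i.e. a
-- bijection ℕ → ℤ.
IsPermutationOfℤ : (ℕ → ℤ) → Set
IsPermutationOfℤ p = Bijective _≡_ _≡_ p

ContainsAP : (k : ℕ) → (ℕ → ℤ) → Set
ContainsAP k p =
  Σ (Fin k → ℕ) λ i →
  Σ ℤ λ a → Σ ℤ λ d →
    (d ≢ 0ℤ) ×
    (∀ (j j′ : Fin k) → j Fin.< j′ → i j <ℕ i j′) ×
    (∀ (j : Fin k) → p (i j) ≡ a + (+ toℕ j) * d)

AvoidsAP : (k : ℕ) → (ℕ → ℤ) → Set
AvoidsAP k p = ¬ ContainsAP k p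

-- The positions ℕ are cut into consecutive blocks 0, 1, 2, … of sizes
-- 8 ^ c.  Block 0 takes the value 0; block c + 1 takes the next 8 ^ (c + 1)
-- unused integers on one side of the values used so far, alternating between
-- the positive and the negative side, so every integer is used exactly once.
-- Inside a block the values are arranged by bit reversal, which contains no
-- 3-term progression.  Given a 6-term progression at positions n₀ < … < n₅,
-- the triples (n₁, n₂, n₃) and (n₃, n₄, n₅) therefore each meet two blocks,
-- so n₃ lies in a block b + 1 after those of n₀ and n₁ and before that of
-- n₅.  Seen from the side where block b + 1 is placed, the common difference
-- is positive and at most the width of the range of blocks 0, …, b, so the
-- sixth term exceeds that range by at most four widths; block b + 1 is at
-- least four widths long, contradicting that n₅ lies in a later block.
module Submission where

open import Defs
open import Data.Nat as ℕ using (ℕ)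
open import Data.Nat.Properties using (n<1+n)
open import Data.Integer using (ℤ)
open import Data.Fin using (#_)
open import Data.Product using (Σ; _×_; _,_)

module BitReversal where
  open import Data.Nat using (ℕ; zero; suc; _+_; _*_; _∸_; _^_; _≤_; _<_; z≤n; s≤s; _<?_)
  open import Data.Nat.Properties
  open import Data.Nat.Tactic.RingSolver using (solve-∀)
  open import Data.Product using (Σ; _×_; _,_)
  open import Data.Sum using (_⊎_; inj₁; inj₂)
  open import Relation.Nullary using (yes; no; contradiction)
  open import Relation.Binary.PropositionalEquality

  -- rev m reverses the m-bit binary expansion of i < 2 ^ m: the lower half of
  -- the block goes to the even numbers, the upper half to the odd numbers.
  rev : ℕ → ℕ → ℕ
  rev zero    i = 0
  rev (suc m) i with i <? 2 ^ m
  ... | yes _ = 2 * rev m i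
  ... | no  _ = suc (2 * rev m (i ∸ 2 ^ m))

  data Half (m : ℕ) : ℕ → Set where
    lower : ∀ {i} → i < 2 ^ m → Half m i
    upper : ∀ {j} → j < 2 ^ m → Half m (2 ^ m + j)

  half : ∀ m {i} → i < 2 ^ suc m → Half m i
  half m {i} i< with i <? 2 ^ m
  ... | yes i<h = lower i<h
  ... | no  i≮h = subst (Half m) i≡h+j (upper (+-cancelˡ-< (2 ^ m) _ _ (subst (_< 2 ^ m + 2 ^ m) (sym i≡h+j) i<′)))
    where
    i≡h+j : 2 ^ m + (i ∸ 2 ^ m) ≡ i
    i≡h+j = m+[n∸m]≡n (≮⇒≥ i≮h)
    i<′ : i < 2 ^ m + 2 ^ m
    i<′ = subst (i <_) (cong (2 ^ m +_) (+-identityʳ (2 ^ m))) i<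

  rev-lower : ∀ m {i} → i < 2 ^ m → rev (suc m) i ≡ 2 * rev m i
  rev-lower m {i} i<h with i <? 2 ^ m
  ... | yes _   = refl
  ... | no  i≮h = contradiction i<h i≮h

  rev-upper : ∀ m j → rev (suc m) (2 ^ m + j) ≡ suc (2 * rev m j)
  rev-upper m j with 2 ^ m + j <? 2 ^ m
  ... | yes h+j<h = contradiction h+j<h (≤⇒≯ (m≤m+n (2 ^ m) j))
  ... | no  _     = cong (λ k → suc (2 * rev m k)) (m+n∸m≡n (2 ^ m) j)

  double-suc : ∀ r → 2 * suc r ≡ suc (suc (2 * r))
  double-suc r = cong suc (+-suc r (r + 0))

  odd-< : ∀ {r h} → r < h → suc (2 * r) < 2 * h
  odd-< {r} {h} r<h = subst (_≤ 2 * h) (double-suc r) (*-monoʳ-≤ 2 r<h)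

  rev-bound : ∀ m {i} → i < 2 ^ m → rev m i < 2 ^ m
  rev-bound zero    _  = s≤s z≤n
  rev-bound (suc m) i< with half m i<
  ... | lower i<h     = subst (_< 2 ^ suc m) (sym (rev-lower m i<h)) (*-monoʳ-< 2 (rev-bound m i<h))
  ... | upper {j} j<h = subst (_< 2 ^ suc m) (sym (rev-upper m j)) (odd-< (rev-bound m j<h))

  rev-injective : ∀ m {i j} → i < 2 ^ m → j < 2 ^ m → rev m i ≡ rev m j → i ≡ j
  rev-injective zero    {zero} {zero} _ _ _ = refl
  rev-injective zero    {suc _} (s≤s ())
  rev-injective zero    {_} {suc _} _ (s≤s ())
  rev-injective (suc m) i< j< e with half m i< | half m j<
  ... | lower i<h | lower j<h =
    rev-injective m i<h j<h (*-cancelˡ-≡ _ _ 2 (trans (sym (rev-lower m i<h)) (trans e (rev-lower m j<h))))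
  ... | lower i<h | upper {j} _ =
    contradiction (trans (sym (rev-lower m i<h)) (trans e (rev-upper m j))) (even≢odd (rev m _) (rev m j))
  ... | upper {i} _ | lower j<h =
    contradiction (trans (sym (rev-lower m j<h)) (trans (sym e) (rev-upper m i))) (even≢odd (rev m _) (rev m i))
  ... | upper {i} i<h | upper {j} j<h =
    cong (2 ^ m +_) (rev-injective m i<h j<h
      (*-cancelˡ-≡ _ _ 2 (suc-injective (trans (sym (rev-upper m i)) (trans e (rev-upper m j))))))

  parity : ∀ v → Σ ℕ λ a → v ≡ 2 * a ⊎ v ≡ suc (2 * a)
  parity zero = 0 , inj₁ refl
  parity (suc v) with parity v
  ... | a , inj₁ v≡2a  = a , inj₂ (cong suc v≡2a)
  ... | a , inj₂ v≡2a+1 = suc a , inj₁ (trans (cong suc v≡2a+1) (sym (double-suc a)))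

  rev-surjective : ∀ m {v} → v < 2 ^ m → Σ ℕ λ i → i < 2 ^ m × rev m i ≡ v
  rev-surjective zero    {zero} _ = 0 , s≤s z≤n , refl
  rev-surjective zero    {suc _} (s≤s ())
  rev-surjective (suc m) {v} v< with parity v
  ... | a , inj₁ refl with rev-surjective m (*-cancelˡ-< 2 a (2 ^ m) v<)
  ...   | i , i<h , ri≡a = i , ≤-trans i<h (m≤m+n (2 ^ m) _) , trans (rev-lower m i<h) (cong (2 *_) ri≡a)
  rev-surjective (suc m) {v} v< | a , inj₂ refl with rev-surjective m (*-cancelˡ-< 2 a (2 ^ m) (<-trans (n<1+n _) v<))
  ...   | i , i<h , ri≡a =
    2 ^ m + i , +-monoʳ-< (2 ^ m) (≤-trans i<h (m≤m+n _ 0)) , trans (rev-upper m i) (cong (λ k → suc (2 * k)) ri≡a)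

  even+even : ∀ a c → 2 * a + 2 * c ≡ 2 * (a + c)
  even+even a c = sym (*-distribˡ-+ 2 a c)

  even+odd : ∀ a c → 2 * a + suc (2 * c) ≡ suc (2 * (a + c))
  even+odd = solve-∀

  odd+odd : ∀ a c → suc (2 * a) + suc (2 * c) ≡ 2 * suc (a + c)
  odd+odd = solve-∀

  -- The bit reversal of a block is free of 3-term arithmetic progressions: for
  -- indices i < j < l in lower and upper half the left side is odd; in a
  -- common half the halving step reduces to the smaller block.
  rev-no3AP : ∀ m {i j l} → i < j → j < l → l < 2 ^ m → rev m i + rev m l ≢ 2 * rev m j
  rev-no3AP zero    _ () (s≤s z≤n)
  rev-no3AP (suc m) {i} {j} {l} i<j j<l l< e with half m (<-trans i<j (<-trans j<l l<)) | half m l<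
  ... | lower i<h | lower l<h =
    rev-no3AP m i<j j<l l<h (*-cancelˡ-≡ _ _ 2 (begin
      2 * (rev m i + rev m l)         ≡⟨ sym (even+even (rev m i) (rev m l)) ⟩
      2 * rev m i + 2 * rev m l       ≡⟨ sym (cong₂ _+_ (rev-lower m i<h) (rev-lower m l<h)) ⟩
      rev (suc m) i + rev (suc m) l   ≡⟨ e ⟩
      2 * rev (suc m) j               ≡⟨ cong (2 *_) (rev-lower m (<-trans j<l l<h)) ⟩
      2 * (2 * rev m j)               ∎))
    where open ≡-Reasoning
  ... | lower i<h | upper {l′} _ =
    even≢odd (rev (suc m) j) (rev m i + rev m l′) (begin
      2 * rev (suc m) j                  ≡⟨ sym e ⟩
      rev (suc m) i + rev (suc m) (2 ^ m + l′) ≡⟨ cong₂ _+_ (rev-lower m i<h) (rev-upper m l′) ⟩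
      2 * rev m i + suc (2 * rev m l′)   ≡⟨ even+odd (rev m i) (rev m l′) ⟩
      suc (2 * (rev m i + rev m l′))     ∎)
    where open ≡-Reasoning
  ... | upper {i′} _ | lower l<h = contradiction (<-trans i<j j<l) (≤⇒≯ (≤-trans (<⇒≤ l<h) (m≤m+n (2 ^ m) i′)))
  ... | upper {i′} i′<h | upper {l′} l′<h with half m (<-trans j<l l<)
  ...   | lower j<h = contradiction i<j (≤⇒≯ (≤-trans (<⇒≤ j<h) (m≤m+n (2 ^ m) i′)))
  ...   | upper {j′} _ =
    rev-no3AP m (+-cancelˡ-< (2 ^ m) _ _ i<j) (+-cancelˡ-< (2 ^ m) _ _ j<l) l′<h
      (suc-injective (*-cancelˡ-≡ _ _ 2 (begin
        2 * suc (rev m i′ + rev m l′)         ≡⟨ sym (odd+odd (rev m i′) (rev m l′)) ⟩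
        suc (2 * rev m i′) + suc (2 * rev m l′) ≡⟨ sym (cong₂ _+_ (rev-upper m i′) (rev-upper m l′)) ⟩
        rev (suc m) (2 ^ m + i′) + rev (suc m) (2 ^ m + l′) ≡⟨ e ⟩
        2 * rev (suc m) (2 ^ m + j′)          ≡⟨ cong (2 *_) (rev-upper m j′) ⟩
        2 * suc (2 * rev m j′)                ∎)))
    where open ≡-Reasoning

module Blocks (B : ℕ → ℕ) (B-pos : ∀ c → 0 ℕ.< B c) where
  open import Data.Nat using (ℕ; zero; suc; _+_; _∸_; _≤_; _<_; z≤n; s≤s; _<?_)
  open import Data.Nat.Properties
  open import Data.Product using (_×_; _,_)
  open import Data.Sum using (inj₁; inj₂)
  open import Relation.Nullary using (yes; no)
  open import Relation.Binary.PropositionalEquality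

  start : ℕ → ℕ
  start zero    = 0
  start (suc c) = start c + B c

  start-mono : ∀ {c c′} → c ≤ c′ → start c ≤ start c′
  start-mono {c′ = zero}   z≤n = ≤-refl
  start-mono {c′ = suc c′} c≤ with m≤n⇒m<n∨m≡n c≤
  ... | inj₁ (s≤s c≤c′) = ≤-trans (start-mono c≤c′) (m≤m+n (start c′) (B c′))
  ... | inj₂ refl       = ≤-refl

  start-≥ : ∀ c → c ≤ start c
  start-≥ zero    = z≤n
  start-≥ (suc c) = subst (_≤ start c + B c) (+-comm c 1) (+-mono-≤ (start-≥ c) (B-pos c))

  record Location (n : ℕ) : Set where
    constructor at
    field
      block    : ℕ
      offset   : ℕ
      offset<B : offset < B block
      position : n ≡ start block + offset

  locate-before : ∀ K {n} → n < start K → Location n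
  locate-before (suc K) {n} n< with n <? start K
  ... | yes n<s = locate-before K n<s
  ... | no  n≮s = at K (n ∸ start K) (+-cancelˡ-< (start K) _ _ (subst (_< start K + B K) (sym n≡) n<)) (sym n≡)
    where
    n≡ : start K + (n ∸ start K) ≡ n
    n≡ = m+[n∸m]≡n (≮⇒≥ n≮s)

  locate : ∀ n → Location n
  locate n = locate-before (suc n) (start-≥ (suc n))

  block-mono : ∀ {c o c′ o′} → o′ < B c′ → start c + o ≤ start c′ + o′ → c ≤ c′
  block-mono {c} {o} {c′} {o′} o′< le = ≮⇒≥ λ c′<c →
    <⇒≱ (<-≤-trans (+-monoʳ-< (start c′) o′<) (≤-trans (start-mono c′<c) (m≤m+n (start c) o))) le

  location-unique : ∀ {c o c′ o′} → o < B c → o′ < B c′ → start c + o ≡ start c′ + o′ → c ≡ c′ × o ≡ o′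
  location-unique {c} o< o′< e with ≤-antisym (block-mono o′< (≤-reflexive e)) (block-mono o< (≤-reflexive (sym e)))
  ... | refl = refl , +-cancelˡ-≡ (start c) _ _ e

module Frames where
  open import Data.Nat using (ℕ; zero; suc)
  open import Data.Integer using (ℤ; +_; -_; _+_; _*_; ∣_∣)
  open import Data.Integer.Properties
  open import Relation.Binary.PropositionalEquality

  -- The integer line seen from side c: reflected once per step, so that
  -- frame c and frame (suc c) point in opposite directions.
  frame : ℕ → ℤ → ℤ
  frame zero    z = z
  frame (suc c) z = - frame c z

  frame-neg : ∀ c z → frame c (- z) ≡ - frame c z
  frame-neg zero    z = refl
  frame-neg (suc c) z = cong -_ (frame-neg c z)

  frame-involutive : ∀ c z → frame c (frame c z) ≡ z
  frame-involutive zero    z = refl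
  frame-involutive (suc c) z = begin
    - frame c (- frame c z)  ≡⟨ cong -_ (frame-neg c (frame c z)) ⟩
    - - frame c (frame c z)  ≡⟨ neg-involutive _ ⟩
    frame c (frame c z)      ≡⟨ frame-involutive c z ⟩
    z                        ∎
    where open ≡-Reasoning

  frame-injective : ∀ c {x y} → frame c x ≡ frame c y → x ≡ y
  frame-injective c {x} {y} e =
    trans (sym (frame-involutive c x)) (trans (cong (frame c) e) (frame-involutive c y))

  frame-+ : ∀ c x y → frame c (x + y) ≡ frame c x + frame c y
  frame-+ zero    x y = refl
  frame-+ (suc c) x y = trans (cong -_ (frame-+ c x y)) (neg-distrib-+ (frame c x) (frame c y))

  frame-scale : ∀ c k z → frame c (+ k * z) ≡ + k * frame c z
  frame-scale zero    k z = refl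
  frame-scale (suc c) k z = trans (cong -_ (frame-scale c k z)) (neg-distribʳ-* (+ k) (frame c z))

  frame-abs : ∀ c z → ∣ frame c z ∣ ≡ ∣ z ∣
  frame-abs zero    z = refl
  frame-abs (suc c) z = trans (∣-i∣≡∣i∣ (frame c z)) (frame-abs c z)

-- Placing nonempty blocks of sizes B 0, B 1, … on the integer line: block 0 is {0},
-- and block c + 1 extends the values used so far by an interval of length
-- B (c + 1) on the positive side of frame c.  Since consecutive frames are
-- opposite, the blocks alternate between the two ends.
module Layout (B : ℕ → ℕ) (B-pos : ∀ c → 0 ℕ.< B c) where
  open import Data.Nat as ℕ using (ℕ; zero; suc; z≤n; s≤s)
  import Data.Nat.Properties as ℕP
  open import Data.Integer using (ℤ; +_; -[1+_]; -_; 0ℤ; _+_; _≤_; _<_; ∣_∣; +≤+; +<+; -≤+; _≤?_)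
  open import Data.Integer.Properties
  open import Data.Product using (Σ; _×_; _,_)
  open import Data.Sum using (_⊎_; inj₁; inj₂)
  open import Relation.Nullary using (yes; no; contradiction)
  open import Data.Empty using (⊥)
  open import Relation.Binary using (tri<; tri≈; tri>)
  open import Relation.Binary.PropositionalEquality
  open import Data.Nat.Tactic.RingSolver using (solve-∀)
  open Frames

  -- In frame c the values of blocks 0, …, c fill the interval [− lo c, hi c].
  hi lo : ℕ → ℕ
  hi zero    = 0
  hi (suc c) = lo c
  lo zero    = 0
  lo (suc c) = hi c ℕ.+ B (suc c)

  val : ℕ → ℕ → ℤ
  val zero    v = 0ℤ
  val (suc c) v = frame c (+ suc (hi c ℕ.+ v))

  InRange : ℕ → ℤ → Set
  InRange c z = - (+ lo c) ≤ frame c z × frame c z ≤ + hi c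

  Outside : ℕ → ℤ → Set
  Outside c z = frame c z < - (+ lo c) ⊎ + hi c < frame c z

  inRange-outside : ∀ {c z} → InRange c z → Outside c z → ⊥
  inRange-outside (lo≤ , _) (inj₁ <lo) = <⇒≱ <lo lo≤
  inRange-outside (_ , ≤hi) (inj₂ hi<) = <⇒≱ hi< ≤hi

  range-suc : ∀ {c z} → InRange c z → InRange (suc c) z
  range-suc {c} {z} (lo≤ , ≤hi) =
    neg-mono-≤ (≤-trans ≤hi (+≤+ (ℕP.m≤m+n (hi c) (B (suc c))))) ,
    subst (- frame c z ≤_) (neg-involutive (+ lo c)) (neg-mono-≤ lo≤)

  range-mono : ∀ {c c′ z} → c ℕ.≤ c′ → InRange c z → InRange c′ z
  range-mono {c′ = zero}   z≤n r = r
  range-mono {c′ = suc c′} c≤ r with ℕP.m≤n⇒m<n∨m≡n c≤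
  ... | inj₁ (s≤s c≤c′) = range-suc (range-mono c≤c′ r)
  ... | inj₂ refl       = r

  val-range : ∀ {c v} → v ℕ.< B c → InRange c (val c v)
  val-range {zero}      _  = +≤+ z≤n , +≤+ z≤n
  val-range {suc c} {v} v< rewrite frame-involutive c (+ suc (hi c ℕ.+ v)) =
    neg-mono-≤ (+≤+ (ℕP.+-monoʳ-< (hi c) v<)) , -≤+

  val-above : ∀ c v → + hi c < frame c (val (suc c) v)
  val-above c v rewrite frame-involutive c (+ suc (hi c ℕ.+ v)) = +<+ (s≤s (ℕP.m≤m+n (hi c) v))

  outside-suc : ∀ {c z} → Outside (suc c) z → frame c z < - (+ lo c) ⊎ + (hi c ℕ.+ B (suc c)) < frame c z
  outside-suc (inj₁ <lo) = inj₂ (neg-cancel-< <lo)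
  outside-suc {c} {z} (inj₂ hi<) = inj₁ (subst (_< - (+ lo c)) (neg-involutive (frame c z)) (neg-mono-< hi<))

  outside-weaken : ∀ {c z} b → frame c z < - (+ lo c) ⊎ + (hi c ℕ.+ b) < frame c z → Outside c z
  outside-weaken b (inj₁ <lo) = inj₁ <lo
  outside-weaken b (inj₂ hi<) = inj₂ (≤-<-trans (+≤+ (ℕP.m≤m+n _ b)) hi<)

  outside-after : ∀ k c v → Outside c (val (k ℕ.+ suc c) v)
  outside-after zero    c v = inj₂ (val-above c v)
  outside-after (suc k) c v = outside-weaken {c} (B (suc c)) (outside-suc {c}
    (subst (λ c′ → Outside (suc c) (val c′ v)) (ℕP.+-suc k (suc c)) (outside-after k (suc c) v)))

  outside-later : ∀ {c c′} v → c ℕ.< c′ → Outside c (val c′ v)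
  outside-later {c} {c′} v c<c′ =
    subst (λ c″ → Outside c (val c″ v)) (ℕP.m∸n+n≡m c<c′) (outside-after (c′ ℕ.∸ suc c) c v)

  -- Distinct (block, offset) pairs receive distinct values, provided block 0
  -- is the single position carrying the value 0.
  val-injective : B 0 ≡ 1 → ∀ {c c′ v v′} → v ℕ.< B c → v′ ℕ.< B c′ →
                  val c v ≡ val c′ v′ → c ≡ c′ × v ≡ v′
  val-injective B₀≡1 {c} {c′} {v} {v′} v< v′< e with ℕP.<-cmp c c′
  ... | tri< c<c′ _ _ =
    contradiction (subst (Outside c) (sym e) (outside-later v′ c<c′)) (inRange-outside {c} (val-range v<))
  ... | tri> _ _ c′<c =
    contradiction (subst (Outside c′) e (outside-later v c′<c)) (inRange-outside {c′} (val-range v′<))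
  ... | tri≈ _ refl _ = refl , same-block c v< v′< e
    where
    same-block : ∀ c {v v′} → v ℕ.< B c → v′ ℕ.< B c → val c v ≡ val c v′ → v ≡ v′
    same-block zero    v< v′< _ =
      trans (ℕP.n<1⇒n≡0 (subst (_ ℕ.<_) B₀≡1 v<)) (sym (ℕP.n<1⇒n≡0 (subst (_ ℕ.<_) B₀≡1 v′<)))
    same-block (suc c) _ _ e = ℕP.+-cancelˡ-≡ (hi c) _ _ (ℕP.suc-injective (+-injective (frame-injective c e)))

  val-3AP : ∀ c {u v w} → val (suc c) u + val (suc c) w ≡ val (suc c) v + val (suc c) v → u ℕ.+ w ≡ 2 ℕ.* v
  val-3AP c {u} {v} {w} e = ℕP.+-cancelˡ-≡ (suc (suc (hi c ℕ.+ hi c))) _ _ (begin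
    suc (suc (hi c ℕ.+ hi c)) ℕ.+ (u ℕ.+ w)       ≡⟨ sym (shift (hi c) u w) ⟩
    suc (hi c ℕ.+ u) ℕ.+ suc (hi c ℕ.+ w)         ≡⟨ sums ⟩
    suc (hi c ℕ.+ v) ℕ.+ suc (hi c ℕ.+ v)         ≡⟨ shift² (hi c) v ⟩
    suc (suc (hi c ℕ.+ hi c)) ℕ.+ 2 ℕ.* v         ∎)
    where
    open ≡-Reasoning
    shift : ∀ h x y → suc (h ℕ.+ x) ℕ.+ suc (h ℕ.+ y) ≡ suc (suc (h ℕ.+ h)) ℕ.+ (x ℕ.+ y)
    shift = solve-∀
    shift² : ∀ h x → suc (h ℕ.+ x) ℕ.+ suc (h ℕ.+ x) ≡ suc (suc (h ℕ.+ h)) ℕ.+ 2 ℕ.* x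
    shift² = solve-∀
    e′ : + suc (hi c ℕ.+ u) + + suc (hi c ℕ.+ w) ≡ + suc (hi c ℕ.+ v) + + suc (hi c ℕ.+ v)
    e′ = frame-injective c (trans (frame-+ c _ _) (trans e (sym (frame-+ c _ _))))
    sums : suc (hi c ℕ.+ u) ℕ.+ suc (hi c ℕ.+ w) ≡ suc (hi c ℕ.+ v) ℕ.+ suc (hi c ℕ.+ v)
    sums = +-injective (trans (pos-+ (suc (hi c ℕ.+ u)) _) (trans e′ (sym (pos-+ (suc (hi c ℕ.+ v)) _))))

  above-decompose : ∀ {h b w} → + h < w → w ≤ + (h ℕ.+ b) → Σ ℕ λ v → v ℕ.< b × w ≡ + suc (h ℕ.+ v)
  above-decompose {h} {b} {+ m} (+<+ h<m) (+≤+ m≤) =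
    v , ℕP.+-cancelˡ-≤ h _ _ (subst (ℕ._≤ h ℕ.+ b) (trans (sym m≡) (sym (ℕP.+-suc h v))) m≤) , cong +_ (sym m≡)
    where
    v : ℕ
    v = m ℕ.∸ suc h
    m≡ : suc (h ℕ.+ v) ≡ m
    m≡ = ℕP.m+[n∸m]≡n h<m

  -- Every integer in the range of frame c is the value of an offset of one of
  -- the blocks 0, …, c: the range of frame c + 1 is that of frame c together
  -- with block c + 1.
  range-covered : ∀ c {z} → InRange c z → Σ ℕ λ c′ → Σ ℕ λ v → v ℕ.< B c′ × val c′ v ≡ z
  range-covered zero    (lo≤ , ≤hi) = 0 , 0 , B-pos 0 , sym (≤-antisym ≤hi lo≤)
  range-covered (suc c) {z} (lo≤ , ≤hi) with frame c z ≤? + hi c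
  ... | yes ≤hi′ = range-covered c (subst (- (+ lo c) ≤_) (neg-involutive _) (neg-mono-≤ ≤hi) , ≤hi′)
  ... | no  ≰hi with above-decompose (≰⇒> ≰hi) (neg-cancel-≤ lo≤)
  ...   | v , v< , w≡ = suc c , v , v< , trans (cong (frame c) (sym w≡)) (frame-involutive c z)

  range-grows : ∀ k → Σ ℕ λ c → k ℕ.≤ hi c × k ℕ.≤ lo c
  range-grows zero    = 0 , z≤n , z≤n
  range-grows (suc k) with range-grows k
  ... | c , k≤hi , k≤lo = suc (suc c) ,
        ℕP.≤-<-trans k≤hi (ℕP.m<m+n (hi c) (B-pos (suc c))) ,
        ℕP.≤-<-trans k≤lo (ℕP.m<m+n (lo c) (B-pos (suc (suc c))))

  abs-bounds : ∀ w → - (+ ∣ w ∣) ≤ w × w ≤ + ∣ w ∣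
  abs-bounds (+ n)    = neg-≤-pos , ≤-refl
  abs-bounds -[1+ n ] = ≤-refl , -≤+

  range-exhausts : ∀ z → Σ ℕ λ c → InRange c z
  range-exhausts z with range-grows ∣ z ∣
  ... | c , ≤hi , ≤lo with abs-bounds (frame c z)
  ...   | lower , upper rewrite frame-abs c z =
    c , ≤-trans (neg-mono-≤ (+≤+ ≤lo)) lower , ≤-trans upper (+≤+ ≤hi)

module Progressions where
  open import Data.Nat as ℕ using (ℕ)
  open import Data.Integer using (ℤ; +_; -_; 0ℤ; _+_; _*_; _≤_; _<_; +≤+; nonNegative)
  open import Data.Integer.Properties
  open import Data.Integer.Tactic.RingSolver using (solve-∀)
  open import Data.Sum using (inj₁; inj₂)
  open import Data.Product using (_×_; _,_)
  open import Relation.Nullary using (contradiction)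
  open import Relation.Binary.PropositionalEquality

  first-term : ∀ α δ → α + + 0 * δ ≡ α
  first-term = solve-∀
  fourth-term : ∀ α δ → α + + 3 * δ ≡ (α + + 1 * δ) + (δ + δ)
  fourth-term = solve-∀
  sixth-term : ∀ α δ → α + + 5 * δ ≡ (α + + 1 * δ) + + 4 * δ
  sixth-term = solve-∀
  difference : ∀ α δ → δ ≡ (α + + 1 * δ) + - α
  difference = solve-∀

  middle-term : ∀ {x y z} a d k → x ≡ a + k * d → y ≡ a + (k + + 1) * d → z ≡ a + (k + + 2) * d → x + z ≡ y + y
  middle-term a d k refl refl refl = identity a d k
    where
    identity : ∀ a d k → (a + k * d) + (a + (k + + 2) * d) ≡ (a + (k + + 1) * d) + (a + (k + + 1) * d)
    identity = solve-∀

  -- If the terms α, α + δ of an arithmetic progression lie in [− L, H] and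
  -- the term α + 3δ exceeds H, then 0 ≤ δ ≤ H + L; hence the term α + 5δ
  -- still lies in [− L, H + S] whenever 4 (H + L) ≤ S.
  escape-bound : ∀ (H L S : ℕ) (α δ : ℤ) → 4 ℕ.* (H ℕ.+ L) ℕ.≤ S →
    - (+ L) ≤ α + + 0 * δ → α + + 1 * δ ≤ + H → + H < α + + 3 * δ →
    - (+ L) ≤ α + + 5 * δ × α + + 5 * δ ≤ + (H ℕ.+ S)
  escape-bound H L S α δ size lo≤ ≤H H< = lower , upper
    where
    open ≤-Reasoning
    term₀ : α + + 0 * δ ≡ α
    term₀ = first-term α δ
    term₃ : α + + 3 * δ ≡ (α + + 1 * δ) + (δ + δ)
    term₃ = fourth-term α δ
    term₅ : α + + 5 * δ ≡ (α + + 1 * δ) + + 4 * δ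
    term₅ = sixth-term α δ

    δ-nonneg : 0ℤ ≤ δ
    δ-nonneg with ≤-total 0ℤ δ
    ... | inj₁ 0≤δ = 0≤δ
    ... | inj₂ δ≤0 = contradiction H< (≤⇒≯ (begin
      α + + 3 * δ              ≡⟨ term₃ ⟩
      (α + + 1 * δ) + (δ + δ)  ≤⟨ +-monoʳ-≤ (α + + 1 * δ) (+-mono-≤ δ≤0 δ≤0) ⟩
      (α + + 1 * δ) + 0ℤ       ≡⟨ +-identityʳ _ ⟩
      α + + 1 * δ              ≤⟨ ≤H ⟩
      + H                      ∎))

    -α≤L : - α ≤ + L
    -α≤L = subst (- α ≤_) (neg-involutive (+ L)) (neg-mono-≤ (subst (- (+ L) ≤_) term₀ lo≤))

    δ-bound : δ ≤ + (H ℕ.+ L)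
    δ-bound = begin
      δ                    ≡⟨ difference α δ ⟩
      (α + + 1 * δ) + - α  ≤⟨ +-mono-≤ ≤H -α≤L ⟩
      + H + + L            ≡⟨ pos-+ H L ⟨
      + (H ℕ.+ L)          ∎

    upper : α + + 5 * δ ≤ + (H ℕ.+ S)
    upper = begin
      α + + 5 * δ               ≡⟨ term₅ ⟩
      (α + + 1 * δ) + + 4 * δ   ≤⟨ +-mono-≤ ≤H (*-monoˡ-≤-nonNeg (+ 4) δ-bound) ⟩
      + H + + 4 * + (H ℕ.+ L)   ≡⟨ cong (_+_ (+ H)) (pos-* 4 (H ℕ.+ L)) ⟨
      + H + + (4 ℕ.* (H ℕ.+ L)) ≤⟨ +-monoʳ-≤ (+ H) (+≤+ size) ⟩
      + H + + S                 ≡⟨ pos-+ H S ⟨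
      + (H ℕ.+ S)               ∎

    lower : - (+ L) ≤ α + + 5 * δ
    lower = begin
      - (+ L)      ≤⟨ lo≤ ⟩
      α + + 0 * δ  ≤⟨ +-monoʳ-≤ α (*-monoʳ-≤-nonNeg δ {{nonNegative δ-nonneg}} (+≤+ {0} {5} ℕ.z≤n)) ⟩
      α + + 5 * δ  ∎

module Construction where
  open import Data.Nat as ℕ using (ℕ; zero; suc; _^_; _≤_; _<_; z≤n; s≤s)
  import Data.Nat.Properties as ℕP
  open import Data.Nat.Tactic.RingSolver using (solve-∀)
  open import Data.Integer as ℤ using (ℤ; +_; -_; _+_; _*_)
  open import Data.Integer.Properties using (<⇒≱)
  open import Data.Product using (Σ; _×_; _,_)
  open import Data.Sum using (inj₁; inj₂)
  open import Data.Empty using (⊥)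
  open import Relation.Binary.PropositionalEquality
  open BitReversal
  open Frames
  open Progressions

  blockSize : ℕ → ℕ
  blockSize c = 2 ^ (3 ℕ.* c)

  blockSize-pos : ∀ c → 0 < blockSize c
  blockSize-pos c = ℕP.m^n>0 2 (3 ℕ.* c)

  open Blocks blockSize blockSize-pos
  open Layout blockSize blockSize-pos
  open Location

  blockSize-suc : ∀ c → blockSize (suc c) ≡ 8 ℕ.* blockSize c
  blockSize-suc c = trans (cong (2 ^_) (ℕP.*-suc 3 c)) (ℕP.^-distribˡ-+-* 2 3 (3 ℕ.* c))

  range-total : ∀ b → 7 ℕ.* (hi b ℕ.+ lo b) ℕ.+ 8 ≡ blockSize (suc b)
  range-total zero    = refl
  range-total (suc b) = begin
    7 ℕ.* (lo b ℕ.+ (hi b ℕ.+ S)) ℕ.+ 8       ≡⟨ regroup (hi b) (lo b) S ⟩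
    (7 ℕ.* (hi b ℕ.+ lo b) ℕ.+ 8) ℕ.+ 7 ℕ.* S ≡⟨ cong (ℕ._+ 7 ℕ.* S) (range-total b) ⟩
    S ℕ.+ 7 ℕ.* S                             ≡⟨⟩
    8 ℕ.* S                                   ≡⟨ blockSize-suc (suc b) ⟨
    blockSize (suc (suc b))                   ∎
    where
    open ≡-Reasoning
    S = blockSize (suc b)
    regroup : ∀ h l s → 7 ℕ.* (l ℕ.+ (h ℕ.+ s)) ℕ.+ 8 ≡ (7 ℕ.* (h ℕ.+ l) ℕ.+ 8) ℕ.+ 7 ℕ.* s
    regroup = solve-∀

  range-size : ∀ b → 4 ℕ.* (hi b ℕ.+ lo b) ≤ blockSize (suc b)
  range-size b = subst (4 ℕ.* r ≤_) (trans (split r) (range-total b)) (ℕP.m≤m+n (4 ℕ.* r) (3 ℕ.* r ℕ.+ 8))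
    where
    r = hi b ℕ.+ lo b
    split : ∀ x → 4 ℕ.* x ℕ.+ (3 ℕ.* x ℕ.+ 8) ≡ 7 ℕ.* x ℕ.+ 8
    split = solve-∀

  entry : ℕ → ℕ → ℤ
  entry c o = val c (rev (3 ℕ.* c) o)

  blockOf : ℕ → ℕ
  blockOf n = block (locate n)

  p : ℕ → ℤ
  p n = entry (blockOf n) (offset (locate n))

  p-at : ∀ {c o} → o < blockSize c → p (start c ℕ.+ o) ≡ entry c o
  p-at {c} {o} o< =
    let l = locate (start c ℕ.+ o)
        (c≡ , o≡) = location-unique {c} {o} {block l} {offset l} o< (offset<B l) (position l)
    in sym (cong₂ entry c≡ o≡)

  located-injective : ∀ {x y} (l : Location x) (l′ : Location y) →
                      entry (block l) (offset l) ≡ entry (block l′) (offset l′) → x ≡ y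
  located-injective (at c o o< refl) (at c′ o′ o′< refl) e
    with val-injective refl {c} {c′} (rev-bound (3 ℕ.* c) o<) (rev-bound (3 ℕ.* c′) o′<) e
  ... | refl , rev≡ = cong (start c ℕ.+_) (rev-injective (3 ℕ.* c) o< o′< rev≡)

  p-injective : ∀ {x y} → p x ≡ p y → x ≡ y
  p-injective = located-injective (locate _) (locate _)

  p-surjective : ∀ z → Σ ℕ λ n → ∀ {m} → m ≡ n → p m ≡ z
  p-surjective z with range-exhausts z
  ... | c , inRange with range-covered c inRange
  ... | c′ , v , v< , val≡ with rev-surjective (3 ℕ.* c′) v<
  ... | o , o< , rev≡ = start c′ ℕ.+ o , λ { refl → trans (p-at {c′} o<) (trans (cong (val c′) rev≡) val≡) }

  blockOf-mono : ∀ {n n′} → n ≤ n′ → blockOf n ≤ blockOf n′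
  blockOf-mono {n} {n′} le =
    block-mono (offset<B (locate n′)) (subst₂ _≤_ (position (locate n)) (position (locate n′)) le)

  block-no3AP : ∀ c {o o′ o″} → o < o′ → o′ < o″ → o″ < blockSize c →
                entry c o + entry c o″ ≢ entry c o′ + entry c o′
  block-no3AP zero    _ () (s≤s z≤n)
  block-no3AP (suc c) o<o′ o′<o″ o″< e = rev-no3AP (3 ℕ.* suc c) o<o′ o′<o″ o″< (val-3AP c e)

  located-no3AP : ∀ {n n′ n″} (l : Location n) (l′ : Location n′) (l″ : Location n″) →
    n < n′ → n′ < n″ → block l ≡ block l″ →
    entry (block l) (offset l) + entry (block l″) (offset l″) ≢
    entry (block l′) (offset l′) + entry (block l′) (offset l′)
  located-no3AP (at c o o< refl) (at c′ o′ o′< refl) (at c″ o″ o″< refl) n<n′ n′<n″ refl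
    with ℕP.≤-antisym {c} {c′} (block-mono o′< (ℕP.<⇒≤ n<n′)) (block-mono o″< (ℕP.<⇒≤ n′<n″))
  ... | refl = block-no3AP c (ℕP.+-cancelˡ-< (start c) _ _ n<n′) (ℕP.+-cancelˡ-< (start c) _ _ n′<n″) o″<

  spread : ∀ {n n′ n″} → n < n′ → n′ < n″ → p n + p n″ ≡ p n′ + p n′ → blockOf n < blockOf n″
  spread n<n′ n′<n″ e = ℕP.≤∧≢⇒< (blockOf-mono (ℕP.<⇒≤ (ℕP.<-trans n<n′ n′<n″)))
    (λ same → located-no3AP (locate _) (locate _) (locate _) n<n′ n′<n″ same e)

  p-inRange : ∀ {n c} → blockOf n ≤ c → InRange c (p n)
  p-inRange {n} {c} le =
    range-mono {blockOf n} {c} {p n} le (val-range {blockOf n} (rev-bound (3 ℕ.* blockOf n) (offset<B (locate n))))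

  p-above : ∀ {n c} → blockOf n ≡ suc c → + hi c ℤ.< frame c (p n)
  p-above {n} {c} eq = subst (λ c′ → + hi c ℤ.< frame c (entry c′ (offset (locate n)))) (sym eq) (val-above c _)

  p-outside : ∀ {n c} → c < blockOf n → Outside c (p n)
  p-outside {n} {c} lt = outside-later {c} {blockOf n} _ lt

  frame-AP : ∀ c a d k → frame c (a + + k * d) ≡ frame c a + + k * frame c d
  frame-AP c a d k = trans (frame-+ c a (+ k * d)) (cong (_+_ (frame c a)) (frame-scale c k d))

  no6AP-across : ∀ b a d → InRange b (a + + 0 * d) → InRange b (a + + 1 * d) →
                 + hi b ℤ.< frame b (a + + 3 * d) → Outside (suc b) (a + + 5 * d) → ⊥
  no6AP-across b a d (lo≤ , _) (_ , ≤hi) hi<₃ out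
    with escape-bound (hi b) (lo b) (blockSize (suc b)) (frame b a) (frame b d) (range-size b)
           (subst (- (+ lo b) ℤ.≤_) (frame-AP b a d 0) lo≤)
           (subst (ℤ._≤ + hi b) (frame-AP b a d 1) ≤hi)
           (subst (+ hi b ℤ.<_) (frame-AP b a d 3) hi<₃)
  ... | lo≤₅ , ≤hi₅ with outside-suc {b} out
  ...   | inj₁ <lo = <⇒≱ (subst (ℤ._< - (+ lo b)) (frame-AP b a d 5) <lo) lo≤₅
  ...   | inj₂ hi< = <⇒≱ (subst (+ (hi b ℕ.+ blockSize (suc b)) ℤ.<_) (frame-AP b a d 5) hi<) ≤hi₅

  predecessor : ∀ {m n} → m < n → Σ ℕ λ b → n ≡ suc b × m ≤ b
  predecessor {n = suc b} (s≤s m≤b) = b , refl , m≤b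

  -- Six increasing positions never carry the progression a, a + d, …, a + 5d:
  -- positions 1, 3, 5 lie in strictly increasing blocks, so with block b + 1
  -- holding position 3, positions 0 and 1 lie in blocks ≤ b and position 5
  -- beyond block b + 1.
  no6AP : ∀ {n₀ n₁ n₂ n₃ n₄ n₅} a d → n₀ < n₁ → n₁ < n₂ → n₂ < n₃ → n₃ < n₄ → n₄ < n₅ →
    p n₀ ≡ a + + 0 * d → p n₁ ≡ a + + 1 * d → p n₂ ≡ a + + 2 * d →
    p n₃ ≡ a + + 3 * d → p n₄ ≡ a + + 4 * d → p n₅ ≡ a + + 5 * d → ⊥
  no6AP {n₀} {n₁} {n₂} {n₃} {n₄} {n₅} a d s₀ s₁ s₂ s₃ s₄ e₀ e₁ e₂ e₃ e₄ e₅
    with predecessor (spread s₁ s₂ (middle-term a d (+ 1) e₁ e₂ e₃))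
  ... | b , c₃≡ , c₁≤b = no6AP-across b a d
          (subst (InRange b) e₀ (p-inRange {n₀} (ℕP.≤-trans (blockOf-mono (ℕP.<⇒≤ s₀)) c₁≤b)))
          (subst (InRange b) e₁ (p-inRange {n₁} c₁≤b))
          (subst (λ z → + hi b ℤ.< frame b z) e₃ (p-above {n₃} c₃≡))
          (subst (Outside (suc b)) e₅ (p-outside {n₅} (subst (_< _) c₃≡ c₃<c₅)))
    where
    c₃<c₅ : blockOf n₃ < blockOf n₅
    c₃<c₅ = spread s₃ s₄ (middle-term a d (+ 3) e₃ e₄ e₅)

open Construction using (p; p-injective; p-surjective; no6AP)

mainTheorem1 : Σ (ℕ → ℤ) λ p → IsPermutationOfℤ p × AvoidsAP 6 p
mainTheorem1 = p , (p-injective , p-surjective) , avoids6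
  where
  avoids6 : AvoidsAP 6 p
  avoids6 (n , a , d , _ , increasing , onAP) =
    no6AP a d
      (increasing (# 0) (# 1) (n<1+n 0)) (increasing (# 1) (# 2) (n<1+n 1)) (increasing (# 2) (# 3) (n<1+n 2))
      (increasing (# 3) (# 4) (n<1+n 3)) (increasing (# 4) (# 5) (n<1+n 4))
      (onAP (# 0)) (onAP (# 1)) (onAP (# 2)) (onAP (# 3)) (onAP (# 4)) (onAP (# 5))
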